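{- Let $(E,\mathcal{S})$ be a set system, $\tau\ge1$ an integer, $X\subseteq E$, $e\in X$, and let $\mathcal{Q}\subseteq\mathcal{S}$ be the collection of all sets containing $e$. Suppose every collection $\mathcal{C}\subseteq\mathcal{Q}$ of cardinality $\tau+1$ is $\tau$-collapsible. Then every collection $\mathcal{P}\subseteq\mathcal{Q}$ is $\tau$-collapsible.
   Context: A set system $(E,\mathcal{S})$ has a finite universe $E$ and a collection $\mathcal{S}$ of subsets of $E$. With $X$ fixed, a collection $\mathcal{P}\subseteq\mathcal{Q}$ is $\tau$-collapsible if there exist sets $S_1,\dots,S_r\in\mathcal{P}$ with $r\le\tau$ such that every element of $X$ covered by some set of $\mathcal{P}$ is also covered by one of $S_1,\dots,S_r$, i.e. $\bigcup_{S\in\mathcal{P}}(S\cap X)=\bigcup_{i=1}^r(S_i\cap X)$. -}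

module Defs where

open import Data.Nat using (ℕ; suc; _≤_)
open import Data.Fin using (Fin)
open import Data.Vec using (lookup)
open import Data.Fin.Subset using (Subset; _∈_; _⊆_; _∩_)
open import Data.List using (List; length)
open import Data.List.Relation.Unary.All using (All)
open import Data.List.Relation.Unary.Any using (Any)
open import Data.List.Relation.Unary.Unique.Propositional using (Unique)
import Data.List.Membership.Propositional as LM
open import Data.Product using (Σ; ∃; _×_; _,_)
open import Data.Bool using (Bool; true; _∧_)
open import Relation.Binary.PropositionalEquality using (_≡_)

-- Universe E = Fin n.
-- A collection of subsets of E is given by its (Boolean) characteristic
-- function on 'Subset n' (every such collection is finite, since Subset n
-- is finite).
Collection : ℕ → Set
Collection n = Subset n → Bool

_∈ᶜ_ : ∀ {n} → Subset n → Collection n → Set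
S ∈ᶜ 𝒫 = 𝒫 S ≡ true

_⊑_ : ∀ {n} → Collection n → Collection n → Set
𝒫 ⊑ 𝒬 = ∀ S → S ∈ᶜ 𝒫 → S ∈ᶜ 𝒬

_∈?_ : ∀ {n} → Fin n → Subset n → Bool
e ∈? S = lookup S e

containing : ∀ {n} → Collection n → Fin n → Collection n
containing 𝒮 e S = 𝒮 S ∧ (e ∈? S)

HasCard : ∀ {n} → Collection n → ℕ → Set
HasCard 𝒞 k = Σ (List (Subset _)) λ l →
  Unique l × length l ≡ k × (∀ S → S ∈ᶜ 𝒞 → S LM.∈ l) × All (_∈ᶜ 𝒞) l

-- τ-collapsible (relative to X): there exist S₁,…,S_r ∈ 𝒫 with r ≤ τ such that
--   ⋃_{S∈𝒫} (S ∩ X) = ⋃_i (S_i ∩ X).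
-- The inclusion ⊇ holds automatically since each S_i ∈ 𝒫; we state both.
Collapsible : ∀ {n} → Subset n → ℕ → Collection n → Set
Collapsible {n} X τ 𝒫 = Σ (List (Subset n)) λ Ss →
  length Ss ≤ τ × All (_∈ᶜ 𝒫) Ss ×
  (∀ (x : Fin n) → (∃ λ S → S ∈ᶜ 𝒫 × x ∈ S ∩ X) → Any (λ Si → x ∈ Si ∩ X) Ss) ×
  (∀ (x : Fin n) → Any (λ Si → x ∈ Si ∩ X) Ss → ∃ λ S → S ∈ᶜ 𝒫 × x ∈ S ∩ X)

module Submission where

-- Nothing about the sets containing e is used: for ANY
-- ambient collection 𝒬, if every (τ+1)-element subcollection of 𝒬 is
-- τ-collapsible, then so is every subcollection 𝒫 ⊑ 𝒬.  We work with lists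
-- of sets that "span" 𝒫: they consist of members of 𝒫 and cover every point
-- of X covered by 𝒫.  The list of all members of 𝒫 spans 𝒫.  Given a
-- duplicate-free spanning list with more than τ entries, split off its first
-- τ+1 entries A; by hypothesis the collection A is collapsed by at most τ of
-- its members Ts, and exchanging A for Ts gives a strictly shorter spanning
-- list.  Deduplicating and repeating, we reach a spanning list of length at
-- most τ, which is exactly a witness of τ-collapsibility.

open import Defs
open import Data.Nat using (ℕ; zero; suc; _≤_; _<_; _+_; z≤n; s≤s; _<?_)
open import Data.Nat.Properties
  using (≤-refl; ≤-trans; ≤-pred; ≮⇒≥; +-monoˡ-≤; m≤n⇒m⊓n≡m; module ≤-Reasoning)
open import Data.Fin using (Fin)
open import Data.Fin.Subset using (Subset; _∈_; _∩_)
open import Data.Bool using (true; false)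
import Data.Bool as Bool
open import Data.Vec using ([]; _∷_)
open import Data.Vec.Properties using (≡-dec)
open import Data.List using (List; []; _∷_; _++_; map; length; take; drop; filter; deduplicate)
open import Data.List.Properties using (length-++; length-take; take++drop≡id; length-deduplicate)
import Data.List.Membership.Propositional as LM
open import Data.List.Membership.Propositional.Properties
  using (∈-++⁺ˡ; ∈-++⁺ʳ; ∈-map⁺; ∈-filter⁺)
open import Data.List.Relation.Unary.All as All using (All)
import Data.List.Relation.Unary.All.Properties as All
open import Data.List.Relation.Unary.Any as Any using (Any; here)
import Data.List.Relation.Unary.Any.Properties as Any
open import Data.List.Relation.Unary.Unique.Propositional using (Unique)
open import Data.List.Relation.Unary.Unique.Propositional.Properties using (take⁺)
open import Data.List.Relation.Unary.Unique.DecPropositional.Properties using (deduplicate-!)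
open import Data.Product using (Σ; ∃; _×_; _,_; proj₁; proj₂)
open import Data.Sum using (inj₁; inj₂)
open import Relation.Nullary using (Dec; yes; no; does)
open import Relation.Nullary.Decidable using (dec-true)
open import Relation.Binary.PropositionalEquality using (_≡_; refl; sym; trans; cong; subst)

allSubsets : (n : ℕ) → List (Subset n)
allSubsets zero    = [] ∷ []
allSubsets (suc n) = map (true ∷_) (allSubsets n) ++ map (false ∷_) (allSubsets n)

∈-allSubsets : ∀ {n} (S : Subset n) → S LM.∈ allSubsets n
∈-allSubsets []          = here refl
∈-allSubsets (true ∷ S)  = ∈-++⁺ˡ (∈-map⁺ (true ∷_) (∈-allSubsets S))
∈-allSubsets {suc n} (false ∷ S) =
  ∈-++⁺ʳ (map (true ∷_) (allSubsets n)) (∈-map⁺ (false ∷_) (∈-allSubsets S))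

_≟ˢ_ : ∀ {n} (S T : Subset n) → Dec (S ≡ T)
_≟ˢ_ = ≡-dec Bool._≟_

module _ {n : ℕ} where
  open import Data.List.Membership.DecPropositional (_≟ˢ_ {n}) using () renaming (_∈?_ to _∈ˡ?_)

  members : List (Subset n) → Collection n
  members Ss S = does (S ∈ˡ? Ss)

  ∈-members⁺ : ∀ {Ss S} → S LM.∈ Ss → S ∈ᶜ members Ss
  ∈-members⁺ {Ss} {S} = dec-true (S ∈ˡ? Ss)

  ∈-members⁻ : ∀ {Ss S} → S ∈ᶜ members Ss → S LM.∈ Ss
  ∈-members⁻ {Ss} {S} isMember with S ∈ˡ? Ss
  ... | yes S∈Ss = S∈Ss
  ∈-members⁻ () | no _

  hasCard-members : ∀ {Ss} → Unique Ss → HasCard (members Ss) (length Ss)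
  hasCard-members {Ss} unique =
    Ss , unique , refl , (λ S → ∈-members⁻) , All.tabulate ∈-members⁺

  elements : Collection n → List (Subset n)
  elements 𝒫 = filter (λ S → 𝒫 S Bool.≟ true) (allSubsets n)

  ∈-elements : ∀ {𝒫 S} → S ∈ᶜ 𝒫 → S LM.∈ elements 𝒫
  ∈-elements {𝒫} {S} = ∈-filter⁺ (λ T → 𝒫 T Bool.≟ true) (∈-allSubsets S)

length-take-≤ : ∀ {A : Set} k (xs : List A) → k ≤ length xs → length (take k xs) ≡ k
length-take-≤ k xs k≤ = trans (length-take k xs) (m≤n⇒m⊓n≡m k≤)

module Spanning {n : ℕ} (X : Subset n) where

  Covered : Collection n → Fin n → Set
  Covered 𝒫 x = ∃ λ S → S ∈ᶜ 𝒫 × x ∈ S ∩ X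

  CoveredBy : List (Subset n) → Fin n → Set
  CoveredBy Ss x = Any (λ S → x ∈ S ∩ X) Ss

  Spans : Collection n → List (Subset n) → Set
  Spans 𝒫 Ss = All (_∈ᶜ 𝒫) Ss × (∀ x → Covered 𝒫 x → CoveredBy Ss x)

  spans⇒collapsible : ∀ {𝒫 Ss τ} → length Ss ≤ τ → Spans 𝒫 Ss → Collapsible X τ 𝒫
  spans⇒collapsible {Ss = Ss} short (inCollection , covers) =
    Ss , short , inCollection , covers ,
    λ x coveredBy → Any.lookup coveredBy , All.lookupAny inCollection coveredBy

  collapsible⇒spans : ∀ {𝒫 τ} → Collapsible X τ 𝒫 →
                      Σ (List (Subset n)) λ Ts → length Ts ≤ τ × Spans 𝒫 Ts
  collapsible⇒spans (Ts , short , inCollection , covers , _) = Ts , short , inCollection , covers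

  elements-spans : ∀ 𝒫 → Spans 𝒫 (elements 𝒫)
  elements-spans 𝒫 =
    All.all-filter (λ S → 𝒫 S Bool.≟ true) (allSubsets n) ,
    λ { x (S , S∈𝒫 , x∈S) → LM.lose (∈-elements S∈𝒫) x∈S }

  deduplicate-spans : ∀ {𝒫 Ss} → Spans 𝒫 Ss → Spans 𝒫 (deduplicate _≟ˢ_ Ss)
  deduplicate-spans (inCollection , covers) =
    All.deduplicate⁺ _≟ˢ_ inCollection ,
    λ x covered → Any.deduplicate⁺ _≟ˢ_ (λ { refl p → p }) (covers x covered)

  exchange : ∀ {𝒫} A B {Ts} → Spans 𝒫 (A ++ B) → Spans (members A) Ts → Spans 𝒫 (Ts ++ B)
  exchange {𝒫} A B {Ts} (inCollection , covers) (inA , coversA) =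
    All.++⁺ (All.map (λ S∈A → All.lookup inColA (∈-members⁻ S∈A)) inA) inColB ,
    covers′
    where
    inColA : All (_∈ᶜ 𝒫) A
    inColA = All.++⁻ˡ A inCollection
    inColB : All (_∈ᶜ 𝒫) B
    inColB = All.++⁻ʳ A inCollection

    covers′ : ∀ x → Covered 𝒫 x → CoveredBy (Ts ++ B) x
    covers′ x covered with Any.++⁻ A (covers x covered)
    ... | inj₂ byB = Any.++⁺ʳ Ts byB
    ... | inj₁ byA =
      let (S , S∈A , x∈S) = LM.find byA
      in Any.++⁺ˡ (coversA x (S , ∈-members⁺ S∈A , x∈S))

  module Reduction (𝒬 : Collection n) (τ : ℕ)
    (small : ∀ 𝒞 → 𝒞 ⊑ 𝒬 → HasCard 𝒞 (suc τ) → Collapsible X τ 𝒞)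
    (𝒫 : Collection n) (𝒫⊑𝒬 : 𝒫 ⊑ 𝒬) where

    -- One exchange step on a duplicate-free spanning list D with |D| > τ:
    -- its first τ+1 entries form a (τ+1)-subcollection of 𝒬, collapsed by
    -- at most τ of them.
    shorten : ∀ D → Unique D → suc τ ≤ length D → Spans 𝒫 D →
              Σ (List (Subset n)) λ Ss → length Ss < length D × Spans 𝒫 Ss
    shorten D unique long spansD = Ts ++ B , shorter , exchange A B spansAB spansA
      where
      A B : List (Subset n)
      A = take (suc τ) D
      B = drop (suc τ) D

      |A| : length A ≡ suc τ
      |A| = length-take-≤ (suc τ) D long

      spansAB : Spans 𝒫 (A ++ B)
      spansAB = subst (Spans 𝒫) (sym (take++drop≡id (suc τ) D)) spansD

      A⊑𝒬 : members A ⊑ 𝒬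
      A⊑𝒬 S S∈A = 𝒫⊑𝒬 S (All.lookup (All.++⁻ˡ A (proj₁ spansAB)) (∈-members⁻ S∈A))

      collapseA : Σ (List (Subset n)) λ Ts → length Ts ≤ τ × Spans (members A) Ts
      collapseA = collapsible⇒spans
        (small (members A) A⊑𝒬 (subst (HasCard (members A)) |A| (hasCard-members (take⁺ (suc τ) unique))))

      Ts : List (Subset n)
      Ts = proj₁ collapseA
      |Ts| : length Ts ≤ τ
      |Ts| = proj₁ (proj₂ collapseA)
      spansA : Spans (members A) Ts
      spansA = proj₂ (proj₂ collapseA)

      shorter : length (Ts ++ B) < length D
      shorter = begin-strict
        length (Ts ++ B)         ≡⟨ length-++ Ts ⟩
        length Ts + length B     <⟨ s≤s (+-monoˡ-≤ (length B) |Ts|) ⟩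
        suc τ + length B         ≡⟨ cong (_+ length B) (sym |A|) ⟩
        length A + length B      ≡⟨ sym (length-++ A) ⟩
        length (A ++ B)          ≡⟨ cong length (take++drop≡id (suc τ) D) ⟩
        length D                 ∎
        where open ≤-Reasoning

    -- Iterate deduplication and exchange; k bounds the length of the list.
    collapse : ∀ k Ss → length Ss ≤ k → Spans 𝒫 Ss → Collapsible X τ 𝒫
    collapse zero    []  _    spansSs = spans⇒collapsible z≤n spansSs
    collapse (suc k) Ss  |Ss| spansSs with τ <? length (deduplicate _≟ˢ_ Ss)
    ... | no ¬long = spans⇒collapsible (≮⇒≥ ¬long) (deduplicate-spans spansSs)
    ... | yes long =
      let (Ss′ , shorter , spansSs′) =
            shorten (deduplicate _≟ˢ_ Ss) (deduplicate-! _≟ˢ_ Ss) long (deduplicate-spans spansSs)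
      in collapse k Ss′ (≤-pred (≤-trans shorter (≤-trans (length-deduplicate _≟ˢ_ Ss) |Ss|))) spansSs′

    collapsible : Collapsible X τ 𝒫
    collapsible = collapse (length (elements 𝒫)) (elements 𝒫) ≤-refl (elements-spans 𝒫)

lemma4 : (n : ℕ) (𝒮 : Collection n) (τ : ℕ) → 1 ≤ τ →
    (X : Subset n) (e : Fin n) → e ∈ X →
    (∀ (𝒞 : Collection n) → 𝒞 ⊑ containing 𝒮 e → HasCard 𝒞 (suc τ) →
      Collapsible X τ 𝒞) →
    ∀ (𝒫 : Collection n) → 𝒫 ⊑ containing 𝒮 e → Collapsible X τ 𝒫
lemma4 n 𝒮 τ _ X e _ small 𝒫 𝒫⊑𝒬 =
  Spanning.Reduction.collapsible X (containing 𝒮 e) τ small 𝒫 𝒫⊑𝒬
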